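{- Let $\Gamma$ be a strictly Deza graph with parameters $(n,k,b,a)$ such that $k=b+1$ and $\beta=\beta(\Gamma)>1$, and let $x$ be a vertex of type (A) with $B(x)=\{x_1,\dots,x_\beta\}$. Then one of the following holds: (1) there is a unique vertex $y\in N(x)$ such that $\{y\}=N(x)\setminus N(x_i)$ for all $x_i\in B(x)$, and moreover $\left|\bigcup_{i=1}^{\beta}(N(x_i)\setminus N(x))\right|=\beta$; (2) there is a unique vertex $z\in N_2(x)$ such that $\{z\}=N(x_i)\setminus N(x)$ for all $x_i\in B(x)$, and moreover $\left|\bigcup_{i=1}^{\beta}(N(x)\setminus N(x_i))\right|=\beta$.
   Context: Graphs are finite, simple, undirected. $N(v)$ is the neighbourhood of $v$ and $N_2(v)$ the set of vertices at distance $2$ from $v$. A Deza graph with parameters $(n,k,b,a)$, $b\ge a$, is a nonempty $k$-regular graph on $n$ vertices in which every pair of distinct vertices has exactly $b$ or exactly $a$ common neighbours; it is strictly Deza if it has diameter $2$ and is not strongly regular. $B(v)=\{u: |N(u)\cap N(v)|=b\}$; $\beta(\Gamma)=|B(v)|$ (independent of $v$). A vertex $v$ is of type (A) if $B(v)\cap N(v)=\emptyset$. -}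

module Defs where

open import Data.Nat using (ℕ; _≤_; _<_)
open import Data.Nat.Properties using (_≟_)
open import Data.Bool using (Bool; true; false)
open import Data.Fin using (Fin)
open import Data.Fin.Subset using (Subset; _∩_; ∣_∣; ⋃; _∈_)
open import Data.Fin.Subset.Properties using (_∈?_)
open import Data.Vec using (tabulate)
open import Data.List using (List; map; filter)
open import Data.List.Base using () renaming (map to lmap)
open import Data.Fin.Base using ()
open import Data.List using (allFin)
open import Data.Product using (Σ; ∃; _×_)
open import Data.Sum using (_⊎_)
open import Relation.Nullary using (¬_; does)
open import Relation.Binary.PropositionalEquality using (_≡_; _≢_)

record Graph (n : ℕ) : Set where
  field
    adj   : Fin n → Fin n → Bool
    sym   : ∀ u v → adj u v ≡ adj v u
    irrefl : ∀ v → adj v v ≡ false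

module _ {n : ℕ} (G : Graph n) where
  open Graph G

  Adj : Fin n → Fin n → Set
  Adj u v = adj u v ≡ true

  N : Fin n → Subset n
  N v = tabulate (λ u → adj v u)

  common : Fin n → Fin n → ℕ
  common u v = ∣ N u ∩ N v ∣

  Dist2 : Fin n → Fin n → Set
  Dist2 v u = u ≢ v × ¬ Adj v u × ∃ (λ w → Adj v w × Adj w u)

  Diameter2 : Set
  Diameter2 = (∀ u v → u ≡ v ⊎ Adj u v ⊎ Dist2 u v) × ∃ (λ u → ∃ (λ v → Dist2 u v))

  Regular : ℕ → Set
  Regular k = ∀ v → ∣ N v ∣ ≡ k

  IsDeza : ℕ → ℕ → ℕ → Set
  IsDeza k b a =
    1 ≤ n × a ≤ b × Regular k ×
    (∀ u v → u ≢ v → common u v ≡ b ⊎ common u v ≡ a)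

  IsSRG : Set
  IsSRG = ∃ λ k → ∃ λ l → ∃ λ m →
    Regular k ×
    (∀ u v → Adj u v → common u v ≡ l) ×
    (∀ u v → u ≢ v → ¬ Adj u v → common u v ≡ m)

  IsStrictlyDeza : ℕ → ℕ → ℕ → Set
  IsStrictlyDeza k b a = IsDeza k b a × Diameter2 × ¬ IsSRG

  B : ℕ → Fin n → Subset n
  B b v = tabulate (λ u → does (common u v ≟ b))

  TypeA : ℕ → Fin n → Set
  TypeA b v = ∀ u → u ∈ B b v → ¬ (u ∈ N v)

BigUnion : ∀ {n} → Subset n → (Fin n → Subset n) → Subset n
BigUnion {n} S f = ⋃ (map f (filter (_∈? S) (allFin n)))

{-# OPTIONS --safe #-}

-- For xᵢ ∈ B(x) we have |N(x) ∩ N(xᵢ)| = b = k − 1, so N(xᵢ) arises from N(x) by swapping a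
-- single vertex yᵢ out for a single vertex zᵢ in; since distinct vertices have distinct
-- neighbourhoods, the pair (yᵢ, zᵢ) determines xᵢ. If yᵢ ≠ yⱼ and zᵢ ≠ zⱼ, then
-- N(xᵢ) ∖ N(xⱼ) = {yⱼ, zᵢ}, so xᵢ and xⱼ have b − 1 = a common neighbours, all inside N(x).
-- A common neighbour w would be adjacent to x, xᵢ, xⱼ outside N(x) and to at least a vertices
-- inside, so deg w ≥ a + 3 > k; with none, a = 0 and b = 1, and a 2-regular graph of
-- diameter 2 in which no two vertices share two neighbours is strongly regular. Hence any
-- two members of B(x) share y or share z, which forces all of them to share y or all to share
-- z, and the other vertex of the swap is then injective on B(x), giving a union of β singletons.
module Submission where

open import Defs
open import Level using (0ℓ)
open import Data.Nat using (ℕ; suc; _+_; _≤_; _<_)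
open import Data.Nat.Properties
  using (_≟_; +-suc; +-comm; +-cancelˡ-≡; +-mono-≤; suc-injective; ≤-reflexive; ≤-antisym;
         <⇒≤; ≤⇒≯; 1+n≰n; module ≤-Reasoning)
open import Data.Bool using (true; false)
import Data.Bool as Bool
open import Data.Fin using (Fin; zero; suc)
open import Data.Fin.Properties using (all?; ¬∀⟶∃¬) renaming (_≟_ to _≟ᶠ_)
open import Data.Fin.Subset
  using (Subset; inside; outside; _∈_; _∉_; _⊆_; _∩_; _∪_; _─_; ⁅_⁆; ∣_∣; ⋃; Nonempty; Empty)
open import Data.Fin.Subset.Properties
open import Data.Vec using ([]; _∷_; here; there; lookup)
open import Data.Vec.Properties using (lookup∘tabulate; []=⇒lookup; lookup⇒[]=; ≡-dec)
open import Data.List as List using (List; []; _∷_; map; filter; length; allFin)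
open import Data.List.Membership.Propositional using () renaming (_∈_ to _∈ₗ_)
open import Data.List.Membership.Propositional.Properties using (∈-filter⁻)
import Data.List.Relation.Unary.All as All
open import Data.List.Relation.Unary.AllPairs using (_∷_)
open import Data.List.Relation.Unary.Any using (here; there)
open import Data.List.Relation.Unary.Unique.Propositional using (Unique)
open import Data.List.Relation.Unary.Unique.Propositional.Properties using (filter⁺; allFin⁺)
open import Data.Product using (Σ; ∃; _×_; _,_; proj₁; proj₂)
import Data.Product as Product
open import Data.Sum using (_⊎_; inj₁; inj₂; [_,_])
import Data.Sum as Sum
open import Data.Empty using (⊥; ⊥-elim)
open import Function using (_∘_; const)
open import Relation.Nullary using (¬_; Dec; yes; no; does; contradiction)
open import Relation.Nullary.Decidable using (_→-dec_)
open import Relation.Unary using (Pred; Decidable)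
open import Relation.Binary.PropositionalEquality using (_≡_; _≢_; refl; sym; trans; cong; subst; module ≡-Reasoning)

private variable
  n : ℕ
  p q : Subset n
  t u v w : Fin n

∣p∩q∣+∣p─q∣≡∣p∣ : ∀ (p q : Subset n) → ∣ p ∩ q ∣ + ∣ p ─ q ∣ ≡ ∣ p ∣
∣p∩q∣+∣p─q∣≡∣p∣ []            []            = refl
∣p∩q∣+∣p─q∣≡∣p∣ (inside ∷ p)  (inside ∷ q)  = cong suc (∣p∩q∣+∣p─q∣≡∣p∣ p q)
∣p∩q∣+∣p─q∣≡∣p∣ (inside ∷ p)  (outside ∷ q) =
  trans (+-suc ∣ p ∩ q ∣ ∣ p ─ q ∣) (cong suc (∣p∩q∣+∣p─q∣≡∣p∣ p q))
∣p∩q∣+∣p─q∣≡∣p∣ (outside ∷ p) (inside ∷ q)  = ∣p∩q∣+∣p─q∣≡∣p∣ p q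
∣p∩q∣+∣p─q∣≡∣p∣ (outside ∷ p) (outside ∷ q) = ∣p∩q∣+∣p─q∣≡∣p∣ p q

x∈p─q⁻ : ∀ (p q : Subset n) → t ∈ p ─ q → t ∈ p × t ∉ q
x∈p─q⁻ (inside ∷ p) (outside ∷ q) here      = here , λ ()
x∈p─q⁻ (_ ∷ p)      (inside ∷ q)  (there m) = Product.map there (λ t∉q → λ { (there t∈q) → t∉q t∈q }) (x∈p─q⁻ p q m)
x∈p─q⁻ (_ ∷ p)      (outside ∷ q) (there m) = Product.map there (λ t∉q → λ { (there t∈q) → t∉q t∈q }) (x∈p─q⁻ p q m)

x∈p⇒⁅x⁆⊆p : t ∈ p → ⁅ t ⁆ ⊆ p
x∈p⇒⁅x⁆⊆p {t = t} t∈p s∈⁅t⁆ rewrite x∈⁅y⁆⇒x≡y t s∈⁅t⁆ = t∈p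

p⊆r∧q⊆r⇒p∪q⊆r : ∀ {r : Subset n} → p ⊆ r → q ⊆ r → p ∪ q ⊆ r
p⊆r∧q⊆r⇒p∪q⊆r {p = p} {q} p⊆r q⊆r m = [ p⊆r , q⊆r ] (x∈p∪q⁻ p q m)

x∈⁅y⁆∪⁅z⁆⇒x≡y∨x≡z : t ∈ ⁅ u ⁆ ∪ ⁅ v ⁆ → t ≡ u ⊎ t ≡ v
x∈⁅y⁆∪⁅z⁆⇒x≡y∨x≡z {u = u} {v} m = Sum.map (x∈⁅y⁆⇒x≡y u) (x∈⁅y⁆⇒x≡y v) (x∈p∪q⁻ ⁅ u ⁆ ⁅ v ⁆ m)

x≡y⇒x∈⁅y⁆ : t ≡ u → t ∈ ⁅ u ⁆
x≡y⇒x∈⁅y⁆ refl = x∈⁅x⁆ _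

⁅⁆-injective : ⁅ u ⁆ ≡ ⁅ v ⁆ → u ≡ v
⁅⁆-injective {u = u} {v} eq = x∈⁅y⁆⇒x≡y v (subst (u ∈_) eq (x∈⁅x⁆ u))

x∈p⇒0<∣p∣ : t ∈ p → 0 < ∣ p ∣
x∈p⇒0<∣p∣ {t = t} {p = p} t∈p = subst (_≤ ∣ p ∣) (∣⁅x⁆∣≡1 t) (p⊆q⇒∣p∣≤∣q∣ (x∈p⇒⁅x⁆⊆p t∈p))

0<∣p∣⇒Nonempty : ∀ (p : Subset n) → 0 < ∣ p ∣ → Nonempty p
0<∣p∣⇒Nonempty (inside ∷ p)  _      = zero , here
0<∣p∣⇒Nonempty (outside ∷ p) 0<∣p∣ = Product.map suc there (0<∣p∣⇒Nonempty p 0<∣p∣)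

Empty⇒∣p∣≡0 : ∀ {n} {p : Subset n} → Empty p → ∣ p ∣ ≡ 0
Empty⇒∣p∣≡0 {n} empty = trans (cong ∣_∣ (Empty-unique empty)) (∣⊥∣≡0 n)

p⊆q∧∣q∣≤∣p∣⇒q⊆p : p ⊆ q → ∣ q ∣ ≤ ∣ p ∣ → q ⊆ p
p⊆q∧∣q∣≤∣p∣⇒q⊆p {p = p} p⊆q ∣q∣≤∣p∣ {t} t∈q with t ∈? p
... | yes t∈p = t∈p
... | no  t∉p = contradiction (p⊂q⇒∣p∣<∣q∣ (p⊆q , t , t∈q , t∉p)) (≤⇒≯ ∣q∣≤∣p∣)

∣p∣≡1⇒p≡⁅x⁆ : ∀ (p : Subset n) → ∣ p ∣ ≡ 1 → ∃ λ t → p ≡ ⁅ t ⁆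
∣p∣≡1⇒p≡⁅x⁆ p ∣p∣≡1 with 0<∣p∣⇒Nonempty p (≤-reflexive (sym ∣p∣≡1))
... | t , t∈p = t , ⊆-antisym (p⊆q∧∣q∣≤∣p∣⇒q⊆p ⁅t⁆⊆p ∣p∣≤∣⁅t⁆∣) ⁅t⁆⊆p
  where
  ⁅t⁆⊆p = x∈p⇒⁅x⁆⊆p t∈p
  ∣p∣≤∣⁅t⁆∣ = ≤-reflexive (trans ∣p∣≡1 (sym (∣⁅x⁆∣≡1 t)))

∣p∣≡1+∣p∩q∣⇒p─q≡⁅x⁆ : ∀ (p q : Subset n) → ∣ p ∣ ≡ suc ∣ p ∩ q ∣ → ∃ λ t → p ─ q ≡ ⁅ t ⁆
∣p∣≡1+∣p∩q∣⇒p─q≡⁅x⁆ p q eq = ∣p∣≡1⇒p≡⁅x⁆ (p ─ q) (+-cancelˡ-≡ ∣ p ∩ q ∣ _ 1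
  (trans (∣p∩q∣+∣p─q∣≡∣p∣ p q) (trans eq (+-comm 1 ∣ p ∩ q ∣))))

x∉p⇒∣⁅x⁆∪p∣≡1+∣p∣ : ∀ (t : Fin n) (p : Subset n) → t ∉ p → ∣ ⁅ t ⁆ ∪ p ∣ ≡ suc ∣ p ∣
x∉p⇒∣⁅x⁆∪p∣≡1+∣p∣ zero    (inside ∷ p)  t∉p = contradiction here t∉p
x∉p⇒∣⁅x⁆∪p∣≡1+∣p∣ zero    (outside ∷ p) _   = cong (suc ∘ ∣_∣) (∪-identityˡ p)
x∉p⇒∣⁅x⁆∪p∣≡1+∣p∣ (suc t) (inside ∷ p)  t∉p = cong suc (x∉p⇒∣⁅x⁆∪p∣≡1+∣p∣ t p (t∉p ∘ there))
x∉p⇒∣⁅x⁆∪p∣≡1+∣p∣ (suc t) (outside ∷ p) t∉p = x∉p⇒∣⁅x⁆∪p∣≡1+∣p∣ t p (t∉p ∘ there)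

x≢y⇒∣⁅x⁆∪⁅y⁆∣≡2 : u ≢ v → ∣ ⁅ u ⁆ ∪ ⁅ v ⁆ ∣ ≡ 2
x≢y⇒∣⁅x⁆∪⁅y⁆∣≡2 {u = u} {v} u≢v =
  trans (x∉p⇒∣⁅x⁆∪p∣≡1+∣p∣ u ⁅ v ⁆ (x≢y⇒x∉⁅y⁆ u≢v)) (cong suc (∣⁅x⁆∣≡1 v))

∣p∣≡2⇒p⊆⁅x⁆∪⁅y⁆ : ∣ p ∣ ≡ 2 → u ∈ p → v ∈ p → u ≢ v → p ⊆ ⁅ u ⁆ ∪ ⁅ v ⁆
∣p∣≡2⇒p⊆⁅x⁆∪⁅y⁆ ∣p∣≡2 u∈p v∈p u≢v =
  p⊆q∧∣q∣≤∣p∣⇒q⊆p (p⊆r∧q⊆r⇒p∪q⊆r (x∈p⇒⁅x⁆⊆p u∈p) (x∈p⇒⁅x⁆⊆p v∈p))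
                   (≤-reflexive (trans ∣p∣≡2 (sym (x≢y⇒∣⁅x⁆∪⁅y⁆∣≡2 u≢v))))

3≤∣p∣ : u ∈ p → v ∈ p → w ∈ p → u ≢ v → u ≢ w → v ≢ w → 3 ≤ ∣ p ∣
3≤∣p∣ {u = u} {p = p} {v} {w} u∈p v∈p w∈p u≢v u≢w v≢w =
  subst (_≤ ∣ p ∣) ∣⁅u⁆∪⁅v⁆∪⁅w⁆∣≡3 (p⊆q⇒∣p∣≤∣q∣ ⁅u⁆∪⁅v⁆∪⁅w⁆⊆p)
  where
  ⁅u⁆∪⁅v⁆∪⁅w⁆⊆p = p⊆r∧q⊆r⇒p∪q⊆r (x∈p⇒⁅x⁆⊆p u∈p)
                    (p⊆r∧q⊆r⇒p∪q⊆r (x∈p⇒⁅x⁆⊆p v∈p) (x∈p⇒⁅x⁆⊆p w∈p))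
  u∉⁅v⁆∪⁅w⁆ : u ∉ ⁅ v ⁆ ∪ ⁅ w ⁆
  u∉⁅v⁆∪⁅w⁆ = [ u≢v , u≢w ] ∘ x∈⁅y⁆∪⁅z⁆⇒x≡y∨x≡z
  ∣⁅u⁆∪⁅v⁆∪⁅w⁆∣≡3 : ∣ ⁅ u ⁆ ∪ ⁅ v ⁆ ∪ ⁅ w ⁆ ∣ ≡ 3
  ∣⁅u⁆∪⁅v⁆∪⁅w⁆∣≡3 = trans (x∉p⇒∣⁅x⁆∪p∣≡1+∣p∣ u _ u∉⁅v⁆∪⁅w⁆) (cong suc (x≢y⇒∣⁅x⁆∪⁅y⁆∣≡2 v≢w))

p─q≡⁅x⁆⇒x∈p∧x∉q : ∀ (p q : Subset n) → p ─ q ≡ ⁅ u ⁆ → u ∈ p × u ∉ q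
p─q≡⁅x⁆⇒x∈p∧x∉q {u = u} p q eq = x∈p─q⁻ p q (subst (u ∈_) (sym eq) (x∈⁅x⁆ u))

p─q≡⁅x⁆∧y∈p∧y∉q⇒y≡x : p ─ q ≡ ⁅ u ⁆ → t ∈ p → t ∉ q → t ≡ u
p─q≡⁅x⁆∧y∈p∧y∉q⇒y≡x {u = u} {t = t} eq t∈p t∉q =
  x∈⁅y⁆⇒x≡y u (subst (t ∈_) eq (x∈p∧x∉q⇒x∈p─q t∈p t∉q))

p─q≡⁅x⁆∧y∈p∧y≢x⇒y∈q : p ─ q ≡ ⁅ u ⁆ → t ∈ p → t ≢ u → t ∈ q
p─q≡⁅x⁆∧y∈p∧y≢x⇒y∈q {q = q} {t = t} eq t∈p t≢u with t ∈? q
... | yes t∈q = t∈q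
... | no  t∉q = contradiction (p─q≡⁅x⁆∧y∈p∧y∉q⇒y≡x eq t∈p t∉q) t≢u

x∈⋃⁻ : ∀ (f : Fin n → Subset n) (is : List (Fin n)) → t ∈ ⋃ (map f is) → ∃ λ i → i ∈ₗ is × t ∈ f i
x∈⋃⁻ f []       t∈⋃ = contradiction t∈⋃ ∉⊥
x∈⋃⁻ f (i ∷ is) t∈⋃ with x∈p∪q⁻ (f i) (⋃ (map f is)) t∈⋃
... | inj₁ t∈fi = i , here refl , t∈fi
... | inj₂ t∈⋃′ = Product.map₂ (Product.map₁ there) (x∈⋃⁻ f is t∈⋃′)

∣⋃-injective-singletons∣ : ∀ (f : Fin n → Subset n) (is : List (Fin n)) → Unique is →
  (g : ∀ {i} → i ∈ₗ is → Fin n) → (∀ {i} (i∈ : i ∈ₗ is) → f i ≡ ⁅ g i∈ ⁆) →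
  (∀ {i j} (i∈ : i ∈ₗ is) (j∈ : j ∈ₗ is) → g i∈ ≡ g j∈ → i ≡ j) →
  ∣ ⋃ (map f is) ∣ ≡ length is
∣⋃-injective-singletons∣ {n} f []       _              _ _      _         = ∣⊥∣≡0 n
∣⋃-injective-singletons∣     f (i ∷ is) (i∉is ∷ uniq) g f≡⁅g⁆ g-inj = begin
  ∣ f i ∪ ⋃ (map f is) ∣        ≡⟨ cong (λ s → ∣ s ∪ ⋃ (map f is) ∣) (f≡⁅g⁆ (here refl)) ⟩
  ∣ ⁅ gi ⁆ ∪ ⋃ (map f is) ∣     ≡⟨ x∉p⇒∣⁅x⁆∪p∣≡1+∣p∣ gi _ gi∉⋃ ⟩
  suc ∣ ⋃ (map f is) ∣          ≡⟨ cong suc (∣⋃-injective-singletons∣ f is uniq (g ∘ there)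
                                     (f≡⁅g⁆ ∘ there) (λ i∈ j∈ → g-inj (there i∈) (there j∈))) ⟩
  suc (length is)               ∎
  where
  open ≡-Reasoning
  gi = g (here refl)
  gi∉⋃ : gi ∉ ⋃ (map f is)
  gi∉⋃ gi∈⋃ with x∈⋃⁻ f is gi∈⋃
  ... | j , j∈is , gi∈fj = All.lookup i∉is j∈is (g-inj (here refl) (there j∈is)
          (x∈⁅y⁆⇒x≡y _ (subst (gi ∈_) (f≡⁅g⁆ (there j∈is)) gi∈fj)))

length-filter-tabulate : ∀ (s : Subset n) {X : Set} {P : Pred X 0ℓ} (P? : Decidable P) (h : Fin n → X) →
  (∀ i → does (P? (h i)) ≡ lookup s i) → length (filter P? (List.tabulate h)) ≡ ∣ s ∣
length-filter-tabulate []      P? h agree = refl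
length-filter-tabulate (_ ∷ s) P? h agree with does (P? (h zero)) | agree zero
... | true  | refl = cong suc (length-filter-tabulate s P? (h ∘ suc) (agree ∘ suc))
... | false | refl = length-filter-tabulate s P? (h ∘ suc) (agree ∘ suc)

does-∈?≡lookup : ∀ (i : Fin n) (s : Subset n) → does (i ∈? s) ≡ lookup s i
does-∈?≡lookup zero    (inside ∷ s)  = refl
does-∈?≡lookup zero    (outside ∷ s) = refl
does-∈?≡lookup (suc i) (_ ∷ s)       = does-∈?≡lookup i s

∣BigUnion-injective-singletons∣ : ∀ (s : Subset n) (f : Fin n → Subset n) →
  (g : ∀ {i} → i ∈ s → Fin n) → (∀ {i} (i∈s : i ∈ s) → f i ≡ ⁅ g i∈s ⁆) →
  (∀ {i j} (i∈s : i ∈ s) (j∈s : j ∈ s) → g i∈s ≡ g j∈s → i ≡ j) →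
  ∣ BigUnion s f ∣ ≡ ∣ s ∣
∣BigUnion-injective-singletons∣ {n} s f g f≡⁅g⁆ g-inj =
  trans (∣⋃-injective-singletons∣ f members (filter⁺ (_∈? s) (allFin⁺ n))
          (g ∘ member) (f≡⁅g⁆ ∘ member) (λ i∈ j∈ → g-inj (member i∈) (member j∈)))
        (length-filter-tabulate s (_∈? s) (λ i → i) (λ i → does-∈?≡lookup i s))
  where
  members = filter (_∈? s) (allFin n)
  member : ∀ {i} → i ∈ₗ members → i ∈ s
  member = proj₂ ∘ ∈-filter⁻ (_∈? s) {xs = allFin n}

does≡true⇒ : ∀ {A : Set} (a? : Dec A) → does a? ≡ true → A
does≡true⇒ (yes a) _ = a

module _ (G : Graph n) where

  Adj⇒∈N : Adj G u v → v ∈ N G u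
  Adj⇒∈N {u = u} {v} uv = lookup⇒[]= v _ (trans (lookup∘tabulate (Graph.adj G u) v) uv)

  ∈N⇒Adj : v ∈ N G u → Adj G u v
  ∈N⇒Adj {v = v} {u} v∈Nu = trans (sym (lookup∘tabulate (Graph.adj G u) v)) ([]=⇒lookup v∈Nu)

  ∈N-sym : v ∈ N G u → u ∈ N G v
  ∈N-sym {v = v} {u} v∈Nu = Adj⇒∈N (trans (Graph.sym G v u) (∈N⇒Adj v∈Nu))

  ∉N-self : u ∉ N G u
  ∉N-self {u = u} u∈Nu with trans (sym (∈N⇒Adj u∈Nu)) (Graph.irrefl G u)
  ... | ()

  ∈N⇒≢ : v ∈ N G u → u ≢ v
  ∈N⇒≢ v∈Nu refl = ∉N-self v∈Nu

  ∈B⇒common≡ : ∀ {b} → v ∈ B G b u → common G v u ≡ b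
  ∈B⇒common≡ {v = v} {u} {b} v∈B =
    does≡true⇒ (common G v u ≟ b) (trans (sym (lookup∘tabulate _ v)) ([]=⇒lookup v∈B))

module _ (G : Graph n) (2-regular : Regular G 2) (diameter2 : Diameter2 G) where

  private
    dist≤2 = proj₁ diameter2

  -- A triangle is then a whole connected component, so diameter 2 leaves no non-adjacent pair.
  triangle-free : v ∈ N G u → w ∈ N G u → w ∈ N G v → ⊥
  triangle-free {v = v} {u} {w} v∈Nu w∈Nu w∈Nv with proj₂ diameter2
  ... | c , d , d≢c , ¬cd , _ = ¬cd (∈N⇒Adj G (adjacent (everywhere c) (everywhere d) (d≢c ∘ sym)))
    where
    OnTriangle : Fin _ → Set
    OnTriangle t = t ≡ u ⊎ t ≡ v ⊎ t ≡ w

    other-neighbours : ∀ {c d e t} → d ∈ N G c → e ∈ N G c → d ≢ e → t ∈ N G c → t ≡ d ⊎ t ≡ e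
    other-neighbours {c} d∈Nc e∈Nc d≢e =
      x∈⁅y⁆∪⁅z⁆⇒x≡y∨x≡z ∘ ∣p∣≡2⇒p⊆⁅x⁆∪⁅y⁆ (2-regular c) d∈Nc e∈Nc d≢e

    closed : ∀ {s t} → OnTriangle s → t ∈ N G s → OnTriangle t
    closed (inj₁ refl)        = inj₂ ∘ other-neighbours v∈Nu w∈Nu (∈N⇒≢ G w∈Nv)
    closed (inj₂ (inj₁ refl)) = [ inj₁ , inj₂ ∘ inj₂ ] ∘ other-neighbours (∈N-sym G v∈Nu) w∈Nv (∈N⇒≢ G w∈Nu)
    closed (inj₂ (inj₂ refl)) = [ inj₁ , inj₂ ∘ inj₁ ] ∘ other-neighbours (∈N-sym G w∈Nu) (∈N-sym G w∈Nv) (∈N⇒≢ G v∈Nu)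

    everywhere : ∀ t → OnTriangle t
    everywhere t with dist≤2 u t
    ... | inj₁ refl                       = inj₁ refl
    ... | inj₂ (inj₁ ut)                  = closed (inj₁ refl) (Adj⇒∈N G ut)
    ... | inj₂ (inj₂ (_ , _ , r , ur , rt)) = closed (closed (inj₁ refl) (Adj⇒∈N G ur)) (Adj⇒∈N G rt)

    adjacent : ∀ {s t} → OnTriangle s → OnTriangle t → s ≢ t → t ∈ N G s
    adjacent (inj₁ refl)        (inj₁ refl)        s≢t = contradiction refl s≢t
    adjacent (inj₁ refl)        (inj₂ (inj₁ refl)) _   = v∈Nu
    adjacent (inj₁ refl)        (inj₂ (inj₂ refl)) _   = w∈Nu
    adjacent (inj₂ (inj₁ refl)) (inj₁ refl)        _   = ∈N-sym G v∈Nu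
    adjacent (inj₂ (inj₁ refl)) (inj₂ (inj₁ refl)) s≢t = contradiction refl s≢t
    adjacent (inj₂ (inj₁ refl)) (inj₂ (inj₂ refl)) _   = w∈Nv
    adjacent (inj₂ (inj₂ refl)) (inj₁ refl)        _   = ∈N-sym G w∈Nu
    adjacent (inj₂ (inj₂ refl)) (inj₂ (inj₁ refl)) _   = ∈N-sym G w∈Nv
    adjacent (inj₂ (inj₂ refl)) (inj₂ (inj₂ refl)) s≢t = contradiction refl s≢t

  common≤1⇒IsSRG : (∀ u v → u ≢ v → common G u v ≤ 1) → IsSRG G
  common≤1⇒IsSRG common≤1 = 2 , 0 , 1 , 2-regular , adjacent-case , nonadjacent-case
    where
    adjacent-case : ∀ u v → Adj G u v → common G u v ≡ 0
    adjacent-case u v uv = Empty⇒∣p∣≡0 λ where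
      (w , w∈Nu∩Nv) → let (w∈Nu , w∈Nv) = x∈p∩q⁻ (N G u) (N G v) w∈Nu∩Nv in
        triangle-free (Adj⇒∈N G uv) w∈Nu w∈Nv
    nonadjacent-case : ∀ u v → u ≢ v → ¬ Adj G u v → common G u v ≡ 1
    nonadjacent-case u v u≢v ¬uv with dist≤2 u v
    ... | inj₁ u≡v                     = contradiction u≡v u≢v
    ... | inj₂ (inj₁ uv)               = contradiction uv ¬uv
    ... | inj₂ (inj₂ (_ , _ , w , uw , wv)) = ≤-antisym (common≤1 u v u≢v)
      (x∈p⇒0<∣p∣ (x∈p∩q⁺ (Adj⇒∈N G uw , ∈N-sym G (Adj⇒∈N G wv))))

module _ (G : Graph n) {b a : ℕ} (a≤b : a ≤ b) (regular : Regular G (suc b))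
         (dichotomy : ∀ u v → u ≢ v → common G u v ≡ b ⊎ common G u v ≡ a) where

  a≤common : u ≢ v → a ≤ common G u v
  a≤common {u = u} {v} u≢v =
    [ (λ common≡b → subst (a ≤_) (sym common≡b) a≤b) , ≤-reflexive ∘ sym ] (dichotomy u v u≢v)

  common≤b : u ≢ v → common G u v ≤ b
  common≤b {u = u} {v} u≢v =
    [ ≤-reflexive , (λ common≡a → subst (_≤ b) (sym common≡a) a≤b) ] (dichotomy u v u≢v)

  N-injective : N G u ≡ N G v → u ≡ v
  N-injective {u = u} {v} Nu≡Nv with u ≟ᶠ v
  ... | yes u≡v = u≡v
  ... | no  u≢v = contradiction (subst (_≤ b) common≡1+b (common≤b u≢v)) 1+n≰n
    where
    common≡1+b : common G u v ≡ suc b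
    common≡1+b = trans (cong (λ s → ∣ N G u ∩ s ∣) (sym Nu≡Nv))
                       (trans (cong ∣_∣ (∩-idem (N G u))) (regular u))

  module _ (x : Fin n) where

    record Swap (xi : Fin n) : Set where
      field
        y z     : Fin n
        removed : N G x ─ N G xi ≡ ⁅ y ⁆
        added   : N G xi ─ N G x ≡ ⁅ z ⁆

      y∈Nx : y ∈ N G x
      y∈Nx = proj₁ (p─q≡⁅x⁆⇒x∈p∧x∉q (N G x) (N G xi) removed)

      y∉Nxi : y ∉ N G xi
      y∉Nxi = proj₂ (p─q≡⁅x⁆⇒x∈p∧x∉q (N G x) (N G xi) removed)

      z∈Nxi : z ∈ N G xi
      z∈Nxi = proj₁ (p─q≡⁅x⁆⇒x∈p∧x∉q (N G xi) (N G x) added)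

      z∉Nx : z ∉ N G x
      z∉Nx = proj₂ (p─q≡⁅x⁆⇒x∈p∧x∉q (N G xi) (N G x) added)

      x≢xi : x ≢ xi
      x≢xi x≡xi = y∉Nxi (subst (λ r → y ∈ N G r) x≡xi y∈Nx)

    open Swap

    swap : ∀ {xi} → xi ∈ B G b x → Swap xi
    swap {xi} xi∈B = record { y = proj₁ Y ; z = proj₁ Z ; removed = proj₂ Y ; added = proj₂ Z }
      where
      common≡b = ∈B⇒common≡ G xi∈B
      Y = ∣p∣≡1+∣p∩q∣⇒p─q≡⁅x⁆ (N G x) (N G xi)
            (trans (regular x) (cong suc (sym (trans (cong ∣_∣ (∩-comm (N G x) (N G xi))) common≡b))))
      Z = ∣p∣≡1+∣p∩q∣⇒p─q≡⁅x⁆ (N G xi) (N G x) (trans (regular xi) (cong suc (sym common≡b)))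

    N⊆N-of-equal-swaps : (I : Swap u) (J : Swap v) → y I ≡ y J → z I ≡ z J → N G u ⊆ N G v
    N⊆N-of-equal-swaps {u = u} {v} I J yI≡yJ zI≡zJ {t} t∈Nu with t ∈? N G x
    ... | yes t∈Nx = p─q≡⁅x⁆∧y∈p∧y≢x⇒y∈q (removed J) t∈Nx
                       (λ t≡yJ → y∉Nxi I (subst (_∈ N G u) (trans t≡yJ (sym yI≡yJ)) t∈Nu))
    ... | no  t∉Nx = subst (_∈ N G v) (sym (trans (p─q≡⁅x⁆∧y∈p∧y∉q⇒y≡x (added I) t∈Nu t∉Nx) zI≡zJ))
                       (z∈Nxi J)

    swap-injective : (I : Swap u) (J : Swap v) → y I ≡ y J → z I ≡ z J → u ≡ v
    swap-injective I J yI≡yJ zI≡zJ = N-injective (⊆-antisym (N⊆N-of-equal-swaps I J yI≡yJ zI≡zJ)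
                                                            (N⊆N-of-equal-swaps J I (sym yI≡yJ) (sym zI≡zJ)))

    module _ {u v} (I : Swap u) (J : Swap v) (yI≢yJ : y I ≢ y J) (zI≢zJ : z I ≢ z J) where

      yJ∈Nu : y J ∈ N G u
      yJ∈Nu = p─q≡⁅x⁆∧y∈p∧y≢x⇒y∈q (removed I) (y∈Nx J) (yI≢yJ ∘ sym)

      distinct-swaps⇒≢ : u ≢ v
      distinct-swaps⇒≢ u≡v = y∉Nxi J (subst (λ r → y J ∈ N G r) u≡v yJ∈Nu)

      distinct-swaps⇒N∩N⊆Nx : N G u ∩ N G v ⊆ N G x
      distinct-swaps⇒N∩N⊆Nx {t} t∈Nu∩Nv with t ∈? N G x | x∈p∩q⁻ (N G u) (N G v) t∈Nu∩Nv
      ... | yes t∈Nx | _            = t∈Nx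
      ... | no  t∉Nx | t∈Nu , t∈Nv = contradiction
        (trans (sym (p─q≡⁅x⁆∧y∈p∧y∉q⇒y≡x (added I) t∈Nu t∉Nx)) (p─q≡⁅x⁆∧y∈p∧y∉q⇒y≡x (added J) t∈Nv t∉Nx)) zI≢zJ

      Nu─Nv≡⁅yJ⁆∪⁅zI⁆ : N G u ─ N G v ≡ ⁅ y J ⁆ ∪ ⁅ z I ⁆
      Nu─Nv≡⁅yJ⁆∪⁅zI⁆ = ⊆-antisym ⊆-pair pair-⊆
        where
        zI∉Nv : z I ∉ N G v
        zI∉Nv zI∈Nv = zI≢zJ (p─q≡⁅x⁆∧y∈p∧y∉q⇒y≡x (added J) zI∈Nv (z∉Nx I))
        pair-⊆ = p⊆r∧q⊆r⇒p∪q⊆r (x∈p⇒⁅x⁆⊆p (x∈p∧x∉q⇒x∈p─q yJ∈Nu (y∉Nxi J)))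
                               (x∈p⇒⁅x⁆⊆p (x∈p∧x∉q⇒x∈p─q (z∈Nxi I) zI∉Nv))
        ⊆-pair : N G u ─ N G v ⊆ ⁅ y J ⁆ ∪ ⁅ z I ⁆
        ⊆-pair {t} t∈Nu─Nv with x∈p─q⁻ (N G u) (N G v) t∈Nu─Nv | t ∈? N G x
        ... | t∈Nu , t∉Nv | yes t∈Nx = x∈p∪q⁺ (inj₁ (x≡y⇒x∈⁅y⁆ (p─q≡⁅x⁆∧y∈p∧y∉q⇒y≡x (removed J) t∈Nx t∉Nv)))
        ... | t∈Nu , _    | no  t∉Nx = x∈p∪q⁺ (inj₂ (x≡y⇒x∈⁅y⁆ (p─q≡⁅x⁆∧y∈p∧y∉q⇒y≡x (added I) t∈Nu t∉Nx)))

      distinct-swaps⇒1+common≡b : suc (common G u v) ≡ b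
      distinct-swaps⇒1+common≡b = suc-injective (begin
        suc (suc (common G u v))          ≡⟨ +-comm 2 (common G u v) ⟩
        common G u v + 2                  ≡⟨ cong (common G u v +_) ∣Nu─Nv∣≡2 ⟨
        common G u v + ∣ N G u ─ N G v ∣  ≡⟨ ∣p∩q∣+∣p─q∣≡∣p∣ (N G u) (N G v) ⟩
        ∣ N G u ∣                         ≡⟨ regular u ⟩
        suc b                             ∎)
        where
        open ≡-Reasoning
        yJ≢zI : y J ≢ z I
        yJ≢zI yJ≡zI = z∉Nx I (subst (_∈ N G x) yJ≡zI (y∈Nx J))
        ∣Nu─Nv∣≡2 = trans (cong ∣_∣ Nu─Nv≡⁅yJ⁆∪⁅zI⁆) (x≢y⇒∣⁅x⁆∪⁅y⁆∣≡2 yJ≢zI)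

      distinct-swaps⇒b≡1+a : b ≡ suc a
      distinct-swaps⇒b≡1+a with dichotomy u v distinct-swaps⇒≢
      ... | inj₁ common≡b = contradiction (≤-reflexive (trans (cong suc (sym common≡b)) distinct-swaps⇒1+common≡b)) 1+n≰n
      ... | inj₂ common≡a = trans (sym distinct-swaps⇒1+common≡b) (cong suc common≡a)

    SharedRemovedVertex : Set
    SharedRemovedVertex =
      Σ (Fin n) (λ y → (y ∈ N G x × (∀ xi → xi ∈ B G b x → N G x ─ N G xi ≡ ⁅ y ⁆))
        × (∀ y′ → y′ ∈ N G x → (∀ xi → xi ∈ B G b x → N G x ─ N G xi ≡ ⁅ y′ ⁆) → y′ ≡ y))
      × ∣ BigUnion (B G b x) (λ xi → N G xi ─ N G x) ∣ ≡ ∣ B G b x ∣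

    SharedAddedVertex : Set
    SharedAddedVertex =
      Σ (Fin n) (λ z → (Dist2 G x z × (∀ xi → xi ∈ B G b x → N G xi ─ N G x ≡ ⁅ z ⁆))
        × (∀ z′ → Dist2 G x z′ → (∀ xi → xi ∈ B G b x → N G xi ─ N G x ≡ ⁅ z′ ⁆) → z′ ≡ z))
      × ∣ BigUnion (B G b x) (λ xi → N G x ─ N G xi) ∣ ≡ ∣ B G b x ∣

    shared-removed : (x₀∈B : u ∈ B G b x) →
      (∀ xi → xi ∈ B G b x → N G x ─ N G xi ≡ ⁅ y (swap x₀∈B) ⁆) → SharedRemovedVertex
    shared-removed x₀∈B all-remove-y₀ = (y I₀ , (y∈Nx I₀ , all-remove-y₀) , unique) , card
      where
      I₀ = swap x₀∈B
      removed≡y₀ : ∀ {xi} (xi∈B : xi ∈ B G b x) → y (swap xi∈B) ≡ y I₀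
      removed≡y₀ xi∈B = ⁅⁆-injective (trans (sym (removed (swap xi∈B))) (all-remove-y₀ _ xi∈B))
      unique : ∀ y′ → y′ ∈ N G x → (∀ xi → xi ∈ B G b x → N G x ─ N G xi ≡ ⁅ y′ ⁆) → y′ ≡ y I₀
      unique _ _ all-remove-y′ = ⁅⁆-injective (trans (sym (all-remove-y′ _ x₀∈B)) (removed I₀))
      card = ∣BigUnion-injective-singletons∣ (B G b x) _ (λ xi∈B → z (swap xi∈B)) (λ xi∈B → added (swap xi∈B))
        (λ i∈B j∈B → swap-injective (swap i∈B) (swap j∈B) (trans (removed≡y₀ i∈B) (sym (removed≡y₀ j∈B))))

    module _ (diameter2 : Diameter2 G) (not-srg : ¬ IsSRG G) (typeA : TypeA G b x) where

      module _ {u v} (u∈B : u ∈ B G b x) (v∈B : v ∈ B G b x) (I : Swap u) (J : Swap v)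
               (yI≢yJ : y I ≢ y J) (zI≢zJ : z I ≢ z J) where

        distinct-swaps⇒disjoint : Empty (N G u ∩ N G v)
        distinct-swaps⇒disjoint (w , w∈Nu∩Nv) =
          1+n≰n (subst (3 + a ≤_) (cong suc (distinct-swaps⇒b≡1+a I J yI≢yJ zI≢zJ)) 3+a≤1+b)
          where
          open ≤-Reasoning
          w∈Nx = distinct-swaps⇒N∩N⊆Nx I J yI≢yJ zI≢zJ w∈Nu∩Nv
          w∈Nu = proj₁ (x∈p∩q⁻ (N G u) (N G v) w∈Nu∩Nv)
          w∈Nv = proj₂ (x∈p∩q⁻ (N G u) (N G v) w∈Nu∩Nv)
          3≤∣Nw─Nx∣ : 3 ≤ ∣ N G w ─ N G x ∣
          3≤∣Nw─Nx∣ = 3≤∣p∣ (x∈p∧x∉q⇒x∈p─q (∈N-sym G w∈Nx) (∉N-self G))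
                             (x∈p∧x∉q⇒x∈p─q (∈N-sym G w∈Nu) (typeA u u∈B))
                             (x∈p∧x∉q⇒x∈p─q (∈N-sym G w∈Nv) (typeA v v∈B))
                             (x≢xi I) (x≢xi J) (distinct-swaps⇒≢ I J yI≢yJ zI≢zJ)
          3+a≤1+b : 3 + a ≤ suc b
          3+a≤1+b = begin
            3 + a                             ≡⟨ +-comm 3 a ⟩
            a + 3                             ≤⟨ +-mono-≤ (a≤common (∈N⇒≢ G w∈Nx ∘ sym)) 3≤∣Nw─Nx∣ ⟩
            common G w x + ∣ N G w ─ N G x ∣  ≡⟨ ∣p∩q∣+∣p─q∣≡∣p∣ (N G w) (N G x) ⟩
            ∣ N G w ∣                         ≡⟨ regular w ⟩
            suc b                             ∎

        distinct-swaps⇒IsSRG : IsSRG G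
        distinct-swaps⇒IsSRG = common≤1⇒IsSRG G 2-regular diameter2 common≤1
          where
          b≡1 : b ≡ 1
          b≡1 = trans (sym (distinct-swaps⇒1+common≡b I J yI≢yJ zI≢zJ))
                      (cong suc (Empty⇒∣p∣≡0 distinct-swaps⇒disjoint))
          2-regular : Regular G 2
          2-regular w = trans (regular w) (cong suc b≡1)
          common≤1 : ∀ s t → s ≢ t → common G s t ≤ 1
          common≤1 _ _ s≢t = subst (_ ≤_) b≡1 (common≤b s≢t)

      removed≢⇒added≡ : u ∈ B G b x → v ∈ B G b x → (I : Swap u) (J : Swap v) → y I ≢ y J → z I ≡ z J
      removed≢⇒added≡ u∈B v∈B I J yI≢yJ with z I ≟ᶠ z J
      ... | yes zI≡zJ = zI≡zJ
      ... | no  zI≢zJ = ⊥-elim (not-srg (distinct-swaps⇒IsSRG u∈B v∈B I J yI≢yJ zI≢zJ))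

      shared-added : (x₀∈B : u ∈ B G b x) (xj∈B : v ∈ B G b x) →
        y (swap xj∈B) ≢ y (swap x₀∈B) → SharedAddedVertex
      shared-added {u = x₀} x₀∈B xj∈B yj≢y₀ = (z I₀ , (z₀∈N₂x , all-add-z₀) , unique) , card
        where
        I₀ = swap x₀∈B
        added≡z₀ : ∀ {xi} (xi∈B : xi ∈ B G b x) → z (swap xi∈B) ≡ z I₀
        added≡z₀ xi∈B with y (swap xi∈B) ≟ᶠ y I₀
        ... | no  yi≢y₀ = removed≢⇒added≡ xi∈B x₀∈B (swap xi∈B) I₀ yi≢y₀
        ... | yes yi≡y₀ =
          trans (removed≢⇒added≡ xi∈B xj∈B (swap xi∈B) (swap xj∈B) (λ yi≡yj → yj≢y₀ (trans (sym yi≡yj) yi≡y₀)))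
                (removed≢⇒added≡ xj∈B x₀∈B (swap xj∈B) I₀ yj≢y₀)
        all-add-z₀ : ∀ xi → xi ∈ B G b x → N G xi ─ N G x ≡ ⁅ z I₀ ⁆
        all-add-z₀ _ xi∈B = trans (added (swap xi∈B)) (cong ⁅_⁆ (added≡z₀ xi∈B))
        z₀∈N₂x : Dist2 G x (z I₀)
        z₀∈N₂x with proj₁ diameter2 x (z I₀)
        ... | inj₁ x≡z₀       = ⊥-elim (typeA x₀ x₀∈B (∈N-sym G (subst (_∈ N G x₀) (sym x≡z₀) (z∈Nxi I₀))))
        ... | inj₂ (inj₁ xz₀) = ⊥-elim (z∉Nx I₀ (Adj⇒∈N G xz₀))
        ... | inj₂ (inj₂ d)   = d
        unique : ∀ z′ → Dist2 G x z′ → (∀ xi → xi ∈ B G b x → N G xi ─ N G x ≡ ⁅ z′ ⁆) → z′ ≡ z I₀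
        unique _ _ all-add-z′ = ⁅⁆-injective (trans (sym (all-add-z′ _ x₀∈B)) (added I₀))
        card = ∣BigUnion-injective-singletons∣ (B G b x) _ (λ xi∈B → y (swap xi∈B)) (λ xi∈B → removed (swap xi∈B))
          (λ i∈B j∈B yi≡yj → swap-injective (swap i∈B) (swap j∈B) yi≡yj (trans (added≡z₀ i∈B) (sym (added≡z₀ j∈B))))

      removes? : ∀ t xi → Dec (xi ∈ B G b x → N G x ─ N G xi ≡ ⁅ t ⁆)
      removes? t xi = xi ∈? B G b x →-dec ≡-dec Bool._≟_ _ _

      shared-removed-or-added : u ∈ B G b x → SharedRemovedVertex ⊎ SharedAddedVertex
      shared-removed-or-added x₀∈B with all? (removes? (y (swap x₀∈B)))
      ... | yes all-remove-y₀ = inj₁ (shared-removed x₀∈B all-remove-y₀)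
      ... | no ¬all-remove-y₀ with ¬∀⟶∃¬ n _ (removes? (y (swap x₀∈B))) ¬all-remove-y₀
      ...   | xj , ¬xj-removes-y₀ with xj ∈? B G b x
      ...     | no  xj∉B = contradiction (λ xj∈B → contradiction xj∈B xj∉B) ¬xj-removes-y₀
      ...     | yes xj∈B = inj₂ (shared-added x₀∈B xj∈B
                  (λ yj≡y₀ → ¬xj-removes-y₀ (const (trans (removed (swap xj∈B)) (cong ⁅_⁆ yj≡y₀)))))

lemma9 : ∀ {n} (G : Graph n) (k b a : ℕ) → IsStrictlyDeza G k b a → k ≡ suc b →
    (x : Fin n) → 1 < ∣ B G b x ∣ → TypeA G b x →
    (Σ (Fin n) (λ y → (y ∈ N G x × (∀ xi → xi ∈ B G b x → N G x ─ N G xi ≡ ⁅ y ⁆))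
        × (∀ y′ → y′ ∈ N G x → (∀ xi → xi ∈ B G b x → N G x ─ N G xi ≡ ⁅ y′ ⁆) → y′ ≡ y))
      × ∣ BigUnion (B G b x) (λ xi → N G xi ─ N G x) ∣ ≡ ∣ B G b x ∣)
    ⊎
    (Σ (Fin n) (λ z → (Dist2 G x z × (∀ xi → xi ∈ B G b x → N G xi ─ N G x ≡ ⁅ z ⁆))
        × (∀ z′ → Dist2 G x z′ → (∀ xi → xi ∈ B G b x → N G xi ─ N G x ≡ ⁅ z′ ⁆) → z′ ≡ z))
      × ∣ BigUnion (B G b x) (λ xi → N G x ─ N G xi) ∣ ≡ ∣ B G b x ∣)
lemma9 G k b a ((_ , a≤b , regular , dichotomy) , diameter2 , not-srg) refl x 1<β typeA =
  shared-removed-or-added G a≤b regular dichotomy x diameter2 not-srg typeA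
    (proj₂ (0<∣p∣⇒Nonempty (B G b x) (<⇒≤ 1<β)))
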